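{- Let $p$ be a prime and let $U\subseteq\mathbb F_p^2$ with $N:=\#U=np-r$, where $1\leq n<p$ and $0\leq r<p-n$ are integers. Suppose that $U$ is not contained in the union of $n$ lines and that the number $D$ of $U$-special directions satisfies $D\leq 1+\frac{p-r}{n+1}$. Let $E$ be the number of $U$-rich directions, and for each direction $m$ let $c_m$ be the number of unordered pairs of distinct points $u,v\in U$ such that the line through them has slope $m$. Then \[\sum_{m\ U\text{ -rich}} c_m\geq\frac{p-n}{2}N-\left(1-\frac1{n+1}\right)r(p-r)+\frac{n-1}{2}NE.\]
   Context: A line of $\mathbb F_p^2$ is either a set $\{(u,v): v=mu-k\}$ with $m,k\in\mathbb F_p$ (slope $m$) or a vertical set $\{(u,v):u=c\}$ (slope $\infty$); directions are elements of $\mathbb F_p\cup\{\infty\}$. For $U\subseteq\mathbb F_p^2$ put $\theta=\#U/p$. A line $\ell$ is $U$-rich if $\#(\ell\cap U)\geq\theta+1$ and $U$-poor if $\#(\ell\cap U)\leq\theta-1$. A direction is $U$-special if some line with that slope is $U$-rich or $U$-poor, and $U$-rich if some line with that slope is $U$-rich. -}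

module Defs where

open import Data.Nat using (ℕ; zero; suc; _+_; _*_; _∸_; _≤_; _<_; NonZero; _≟_; _≤?_; _<?_)
open import Data.Nat.DivMod using (_%_)
open import Data.Fin using (Fin; toℕ)
open import Data.Fin.Properties using () renaming (_≟_ to _≟ᶠ_)
open import Data.Bool using (T?; Bool; true; false; if_then_else_; _∧_; _∨_; not)
open import Data.List using (List; _∷_; map; concatMap; length; filter)
open import Data.Bool.ListAction using (any)
open import Data.Nat.ListAction using (sum)
open import Data.List.Base using (allFin)
open import Data.Maybe using (Maybe; just; nothing)
open import Data.Product using (_×_; _,_; Σ; ∃)
open import Relation.Nullary.Decidable using (⌊_⌋)
open import Relation.Binary.PropositionalEquality using (_≡_)

-- Elements of F_p are represented by Fin p (residues 0..p-1).
-- Points of F_p^2 are pairs (u , v).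
Point : ℕ → Set
Point p = Fin p × Fin p

SubsetF : ℕ → Set
SubsetF p = Fin p → Fin p → Bool

-- Directions: just m is the slope m ∈ F_p, nothing is the slope ∞.
Dir : ℕ → Set
Dir p = Maybe (Fin p)

-- A line: its direction together with a parameter in F_p.
--   (just m , k) is {(u,v) : v = m u - k}, i.e. v + k ≡ m u (mod p)
--   (nothing , c) is the vertical line {(u,v) : u = c}.
Line : ℕ → Set
Line p = Dir p × Fin p

module _ (p : ℕ) .{{_ : NonZero p}} where

  onLine : Line p → Point p → Bool
  onLine (just m , k)  (u , v) = ⌊ ((toℕ v + toℕ k) % p) ≟ ((toℕ m * toℕ u) % p) ⌋
  onLine (nothing , c) (u , v) = ⌊ u ≟ᶠ c ⌋

  points : List (Point p)
  points = concatMap (λ u → map (λ v → (u , v)) (allFin p)) (allFin p)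

  dirs : List (Dir p)
  dirs = nothing ∷ map just (allFin p)

  inU : SubsetF p → Point p → Bool
  inU U (u , v) = U u v

  count : {A : Set} → (A → Bool) → List A → ℕ
  count f xs = length (filter (λ x → T? (f x)) xs)

  card : SubsetF p → ℕ
  card U = count (inU U) points

  lineCount : SubsetF p → Line p → ℕ
  lineCount U ℓ = count (λ x → inU U x ∧ onLine ℓ x) points

  -- With θ = #U / p:
  --   ℓ is U-rich  iff #(ℓ∩U) ≥ θ + 1  iff  p·#(ℓ∩U) ≥ #U + p
  --   ℓ is U-poor  iff #(ℓ∩U) ≤ θ - 1  iff  p·#(ℓ∩U) + p ≤ #U
  richLine : SubsetF p → Line p → Bool
  richLine U ℓ = ⌊ card U + p ≤? p * lineCount U ℓ ⌋

  poorLine : SubsetF p → Line p → Bool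
  poorLine U ℓ = ⌊ p * lineCount U ℓ + p ≤? card U ⌋

  specialDir : SubsetF p → Dir p → Bool
  specialDir U d = any (λ k → richLine U (d , k) ∨ poorLine U (d , k)) (allFin p)

  richDir : SubsetF p → Dir p → Bool
  richDir U d = any (λ k → richLine U (d , k)) (allFin p)

  numSpecial : SubsetF p → ℕ
  numSpecial U = count (specialDir U) dirs

  numRich : SubsetF p → ℕ
  numRich U = count (richDir U) dirs

  -- points are ordered by their index u·p + v; an unordered pair of distinct
  -- points {P,Q} is counted once as the ordered pair with index P < index Q.
  index : Point p → ℕ
  index (u , v) = toℕ u * p + toℕ v

  -- the line through two distinct points has slope d iff some line of slope d
  -- contains both (the line through two distinct points is unique)
  throughSlope : Dir p → Point p → Point p → Bool
  throughSlope d P Q = any (λ k → onLine (d , k) P ∧ onLine (d , k) Q) (allFin p)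

  pairCount : SubsetF p → Dir p → ℕ
  pairCount U d =
    sum (map (λ P → count (λ Q → inU U P ∧ inU U Q ∧ ⌊ _<?_ (index P) (index Q) ⌋
                                   ∧ throughSlope d P Q) points) points)

  richPairSum : SubsetF p → ℕ
  richPairSum U = sum (map (λ d → if richDir U d then pairCount U d else 0) dirs)

  CoveredBy : (n : ℕ) → SubsetF p → (Fin n → Line p) → Set
  CoveredBy n U ls = (P : Point p) → inU U P ≡ true → ∃ λ (i : Fin n) → onLine (ls i) P ≡ true

module Submission where

-- For a direction d let a(d,k) be the number of points of U on the k-th line of slope d.
-- Counting ordered pairs of points of U by the line through them gives Σₖ a(d,k)² = 2 c_d + N
-- for every d, and, since two distinct points share exactly one line and a point lies on p + 1,
-- Σ_d Σₖ a(d,k)² = N (N + p). On a direction that is not rich every line carries at most n points,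
-- so Σₖ a(d,k)² ≤ n N; on a direction that is not special every line carries n − 1 or n points,
-- so Σₖ a(d,k)² = (2n − 1) N − p n (n − 1). What remains of N (N + p) bounds 2 Σ_{m rich} c_m + E N
-- from below, and the bound on D (the rich directions plus the special non-rich ones) turns this
-- into the claim.

open import Defs
open import Data.Bool using (Bool; true; false; _∧_; _∨_; not; if_then_else_; T; T?)
open import Data.Bool.Properties using (∨-zeroʳ; ∨-conicalˡ; ∨-conicalʳ; ∧-conicalˡ)
open import Data.Bool.ListAction using (any)
open import Data.Empty using (⊥-elim)
open import Data.Fin using (Fin; zero; suc; toℕ; fromℕ<; punchOut)
open import Data.Fin.Properties using (toℕ<n; toℕ-fromℕ<; toℕ-injective; punchOut-injective; pigeonhole)
  renaming (_≟_ to _≟ᶠ_; any? to anyFin?; <-irrefl to <ᶠ-irrefl; suc-injective to suc-injectiveᶠ)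
open import Data.List using (List; []; _∷_; map; concatMap; length; filter; allFin; tabulate; _++_; concat)
open import Data.List.Membership.Propositional using (lose)
open import Data.List.Membership.Propositional.Properties using (∈-allFin)
open import Data.List.Properties using (length-tabulate)
open import Data.List.Relation.Unary.Any.Properties using (any⁺)
open import Data.Maybe using (just; nothing)
open import Data.Nat
open import Data.Nat.DivMod
  using (_%_; _/_; m≡m%n+[m/n]*n; m%n%n≡m%n; [m+n]%n≡m%n; [m+kn]%n≡m%n; m*n%n≡0; m%n<n; m%n≤n; m<n⇒m%n≡m
        ; %-distribˡ-+)
open import Data.Nat.Divisibility using (_∣_; m%n≡0⇒n∣m; ∣⇒≤)
open import Data.Nat.ListAction using (sum)
open import Data.Nat.Primality using (Prime; euclidsLemma)
open import Data.Nat.Properties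
open import Data.Nat.Tactic.RingSolver using (solve-∀)
open import Data.Product using (_,_; Σ; ∃; proj₁; proj₂)
open import Data.Sum using (inj₁; inj₂)
open import Data.Unit using (tt)
open import Function using (_∘_)
open import Relation.Binary.Definitions using (tri<; tri≈; tri>)
open import Relation.Binary.PropositionalEquality
open import Relation.Nullary using (¬_; yes; no; Dec)
open import Relation.Nullary.Decidable using (⌊_⌋)

∑ : {A : Set} → List A → (A → ℕ) → ℕ
∑ xs f = sum (map f xs)

infix 5 ∑
syntax ∑ xs (λ x → e) = ∑[ x ∈ xs ] e

module _ {A : Set} where

  ∑-cong : ∀ (xs : List A) {f g : A → ℕ} → (∀ x → f x ≡ g x) → ∑ xs f ≡ ∑ xs g
  ∑-cong []       f≗g = refl
  ∑-cong (x ∷ xs) f≗g = cong₂ _+_ (f≗g x) (∑-cong xs f≗g)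

  ∑-mono-≤ : ∀ (xs : List A) {f g : A → ℕ} → (∀ x → f x ≤ g x) → ∑ xs f ≤ ∑ xs g
  ∑-mono-≤ []       f≤g = z≤n
  ∑-mono-≤ (x ∷ xs) f≤g = +-mono-≤ (f≤g x) (∑-mono-≤ xs f≤g)

  ∑-+ : ∀ (xs : List A) (f g : A → ℕ) → ∑[ x ∈ xs ] (f x + g x) ≡ ∑ xs f + ∑ xs g
  ∑-+ []       f g = refl
  ∑-+ (x ∷ xs) f g = trans (cong (f x + g x +_) (∑-+ xs f g)) (+-+-swap (f x) (g x) (∑ xs f) (∑ xs g))
    where
    +-+-swap : ∀ a b c d → a + b + (c + d) ≡ a + c + (b + d)
    +-+-swap = solve-∀

  ∑-*ˡ : ∀ (xs : List A) (c : ℕ) (f : A → ℕ) → ∑[ x ∈ xs ] c * f x ≡ c * ∑ xs f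
  ∑-*ˡ []       c f = sym (*-zeroʳ c)
  ∑-*ˡ (x ∷ xs) c f = trans (cong (c * f x +_) (∑-*ˡ xs c f)) (sym (*-distribˡ-+ c (f x) (∑ xs f)))

  ∑-*ʳ : ∀ (xs : List A) (c : ℕ) (f : A → ℕ) → ∑[ x ∈ xs ] f x * c ≡ ∑ xs f * c
  ∑-*ʳ xs c f = trans (∑-cong xs (λ x → *-comm (f x) c)) (trans (∑-*ˡ xs c f) (*-comm c (∑ xs f)))

  ∑-const : ∀ (xs : List A) c → ∑[ _ ∈ xs ] c ≡ length xs * c
  ∑-const []       c = refl
  ∑-const (x ∷ xs) c = cong (c +_) (∑-const xs c)

  ∑-++ : ∀ (xs ys : List A) f → ∑ (xs ++ ys) f ≡ ∑ xs f + ∑ ys f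
  ∑-++ []       ys f = refl
  ∑-++ (x ∷ xs) ys f = trans (cong (f x +_) (∑-++ xs ys f)) (sym (+-assoc (f x) (∑ xs f) (∑ ys f)))

module _ {A B : Set} where

  ∑-map : ∀ (xs : List A) (g : A → B) f → ∑ (map g xs) f ≡ ∑ xs (f ∘ g)
  ∑-map []       g f = refl
  ∑-map (x ∷ xs) g f = cong (f (g x) +_) (∑-map xs g f)

  ∑-concatMap : ∀ (xs : List A) (g : A → List B) f → ∑ (concatMap g xs) f ≡ ∑[ x ∈ xs ] ∑ (g x) f
  ∑-concatMap []       g f = refl
  ∑-concatMap (x ∷ xs) g f = trans (∑-++ (g x) (concat (map g xs)) f) (cong (∑ (g x) f +_) (∑-concatMap xs g f))

  ∑-comm : ∀ (xs : List A) (ys : List B) (f : A → B → ℕ) →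
           ∑[ x ∈ xs ] ∑[ y ∈ ys ] f x y ≡ ∑[ y ∈ ys ] ∑[ x ∈ xs ] f x y
  ∑-comm []       ys f = sym (trans (∑-const ys 0) (*-zeroʳ (length ys)))
  ∑-comm (x ∷ xs) ys f =
    trans (cong (∑ ys (f x) +_) (∑-comm xs ys f)) (sym (∑-+ ys (f x) (λ y → ∑[ x ∈ xs ] f x y)))

∑-allFin-const : ∀ n c → ∑[ _ ∈ allFin n ] c ≡ n * c
∑-allFin-const n c = trans (∑-const (allFin n) c) (cong (_* c) (length-tabulate {n = n} (λ k → k)))

module _ {A : Set} (f : A → ℕ) where

  ∑-tabulate-vanish : ∀ {n} (h : Fin n → A) → (∀ k → f (h k) ≡ 0) → ∑ (tabulate h) f ≡ 0
  ∑-tabulate-vanish {zero}  h vanish = refl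
  ∑-tabulate-vanish {suc n} h vanish = cong₂ _+_ (vanish zero) (∑-tabulate-vanish (h ∘ suc) (vanish ∘ suc))

  ∑-tabulate-single : ∀ {n} (h : Fin n → A) k₀ → (∀ k → k ≢ k₀ → f (h k) ≡ 0) → ∑ (tabulate h) f ≡ f (h k₀)
  ∑-tabulate-single h zero vanish =
    trans (cong (f (h zero) +_) (∑-tabulate-vanish (h ∘ suc) (λ k → vanish (suc k) λ ()))) (+-identityʳ _)
  ∑-tabulate-single h (suc k₀) vanish =
    trans (cong (_+ ∑ (tabulate (h ∘ suc)) f) (vanish zero λ ()))
          (∑-tabulate-single (h ∘ suc) k₀ (λ k k≢k₀ → vanish (suc k) (k≢k₀ ∘ suc-injectiveᶠ)))

⟦_⟧ : Bool → ℕ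
⟦ b ⟧ = if b then 1 else 0

⟦⟧-∧ : ∀ a b → ⟦ a ∧ b ⟧ ≡ ⟦ a ⟧ * ⟦ b ⟧
⟦⟧-∧ true  b = sym (+-identityʳ ⟦ b ⟧)
⟦⟧-∧ false b = refl

⟦⟧-idem : ∀ a → ⟦ a ⟧ * ⟦ a ⟧ ≡ ⟦ a ⟧
⟦⟧-idem true  = refl
⟦⟧-idem false = refl

⟦⟧≤1 : ∀ a → ⟦ a ⟧ ≤ 1
⟦⟧≤1 true  = s≤s z≤n
⟦⟧≤1 false = z≤n

if-then-0≡⟦⟧* : ∀ b x → (if b then x else 0) ≡ ⟦ b ⟧ * x
if-then-0≡⟦⟧* true  x = sym (+-identityʳ x)
if-then-0≡⟦⟧* false x = refl

module _ {A : Set} where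

  count≡∑ : ∀ (f : A → Bool) xs → length (filter (λ x → T? (f x)) xs) ≡ ∑[ x ∈ xs ] ⟦ f x ⟧
  count≡∑ f []       = refl
  count≡∑ f (x ∷ xs) with f x
  ... | true  = cong suc (count≡∑ f xs)
  ... | false = count≡∑ f xs

  ⟦any⟧≡∑ : ∀ (f : A → Bool) xs → ∑[ x ∈ xs ] ⟦ f x ⟧ ≤ 1 → ⟦ any f xs ⟧ ≡ ∑[ x ∈ xs ] ⟦ f x ⟧
  ⟦any⟧≡∑ f []       _   = refl
  ⟦any⟧≡∑ f (x ∷ xs) ∑≤1 with f x
  ... | true  = cong suc (sym (n≤0⇒n≡0 (s≤s⁻¹ ∑≤1)))
  ... | false = ⟦any⟧≡∑ f xs ∑≤1

  any-∨ : ∀ (f g : A → Bool) xs → any (λ x → f x ∨ g x) xs ≡ any f xs ∨ any g xs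
  any-∨ f g []       = refl
  any-∨ f g (x ∷ xs) with f x | g x
  ... | true  | _     = refl
  ... | false | true  = sym (∨-zeroʳ (any f xs))
  ... | false | false = any-∨ f g xs

any-allFin-false : ∀ {n} (f : Fin n → Bool) → any f (allFin n) ≡ false → ∀ k → f k ≡ false
any-allFin-false f none k with f k in fk
... | false = refl
... | true  = ⊥-elim (subst T none (any⁺ f (lose (∈-allFin k) (subst T (sym fk) tt))))

⌊⌋≡false⇒¬ : ∀ {A : Set} (a? : Dec A) → ⌊ a? ⌋ ≡ false → ¬ A
⌊⌋≡false⇒¬ (no ¬a) _ = ¬a

⟦∨⟧ : ∀ a b → ⟦ a ∨ b ⟧ ≡ ⟦ a ⟧ + ⟦ not a ∧ b ⟧
⟦∨⟧ true  b = refl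
⟦∨⟧ false b = refl

⟦⟧-partition : ∀ a b → ⟦ a ⟧ + ⟦ not a ∧ b ⟧ + ⟦ not (a ∨ b) ⟧ ≡ 1
⟦⟧-partition true  b     = refl
⟦⟧-partition false true  = refl
⟦⟧-partition false false = refl

⟦⟧*-mono-≤ : ∀ c {x y} → (c ≡ true → x ≤ y) → ⟦ c ⟧ * x ≤ ⟦ c ⟧ * y
⟦⟧*-mono-≤ true  x≤y = +-monoˡ-≤ 0 (x≤y refl)
⟦⟧*-mono-≤ false _   = z≤n

⟦⟧*-cong : ∀ c {x y} → (c ≡ true → x ≡ y) → ⟦ c ⟧ * x ≡ ⟦ c ⟧ * y
⟦⟧*-cong true  x≡y = cong (_+ 0) (x≡y refl)
⟦⟧*-cong false _   = refl

not≡true⇒≡false : ∀ {a} → not a ≡ true → a ≡ false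
not≡true⇒≡false {false} _ = refl

δ : ∀ {n} → Fin n → Fin n → ℕ
δ a b = ⟦ ⌊ a ≟ᶠ b ⌋ ⟧

δ-refl : ∀ {n} (a : Fin n) → δ a a ≡ 1
δ-refl a with a ≟ᶠ a
... | yes _   = refl
... | no a≢a = ⊥-elim (a≢a refl)

δ-≢ : ∀ {n} {a b : Fin n} → a ≢ b → δ a b ≡ 0
δ-≢ {a = a} {b} a≢b with a ≟ᶠ b
... | yes a≡b = ⊥-elim (a≢b a≡b)
... | no _    = refl

δ-sym : ∀ {n} (a b : Fin n) → δ a b ≡ δ b a
δ-sym a b with a ≟ᶠ b | b ≟ᶠ a
... | yes _   | yes _   = refl
... | no _    | no _    = refl
... | yes a≡b | no b≢a = ⊥-elim (b≢a (sym a≡b))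
... | no a≢b  | yes b≡a = ⊥-elim (a≢b (sym b≡a))

∑-δ : ∀ n (k₀ : Fin n) (g : Fin n → ℕ) → ∑[ k ∈ allFin n ] δ k k₀ * g k ≡ g k₀
∑-δ n k₀ g = trans (∑-tabulate-single (λ k → δ k k₀ * g k) (λ k → k) k₀ λ k k≢k₀ → cong (_* g k) (δ-≢ k≢k₀))
                   (trans (cong (_* g k₀) (δ-refl k₀)) (+-identityʳ (g k₀)))

∑-δ≡1 : ∀ n (k₀ : Fin n) → ∑[ k ∈ allFin n ] δ k k₀ ≡ 1
∑-δ≡1 n k₀ = trans (∑-cong (allFin n) (λ k → sym (*-identityʳ (δ k k₀)))) (∑-δ n k₀ (λ _ → 1))

module Modular (p : ℕ) .{{_ : NonZero p}} where

  infix 4 _≈_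
  _≈_ : ℕ → ℕ → Set
  a ≈ b = a % p ≡ b % p

  +-cong-≈ : ∀ {a b c d} → a ≈ b → c ≈ d → a + c ≈ b + d
  +-cong-≈ {a} {b} {c} {d} a≈b c≈d =
    trans (%-distribˡ-+ a c p) (trans (cong₂ (λ x y → (x + y) % p) a≈b c≈d) (sym (%-distribˡ-+ b d p)))

  %-≈ : ∀ a → a % p ≈ a
  %-≈ a = m%n%n≡m%n a p

  -- c + (p ∸ c % p) is a multiple of p, so adding it undoes adding c.
  +-cancelʳ-≈ : ∀ a b c → a + c ≈ b + c → a ≈ b
  +-cancelʳ-≈ a b c a+c≈b+c = trans (sym (undo a)) (trans (+-cong-≈ a+c≈b+c refl) (undo b))
    where
    open ≡-Reasoning
    c+c⁻≡ : c + (p ∸ c % p) ≡ suc (c / p) * p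
    c+c⁻≡ = begin
      c + (p ∸ c % p)                    ≡⟨ cong (_+ (p ∸ c % p)) (m≡m%n+[m/n]*n c p) ⟩
      c % p + c / p * p + (p ∸ c % p)    ≡⟨ shuffle (c % p) (c / p * p) (p ∸ c % p) ⟩
      c / p * p + (c % p + (p ∸ c % p))  ≡⟨ cong (c / p * p +_) (m+[n∸m]≡n (m%n≤n c p)) ⟩
      c / p * p + p                      ≡⟨ +-comm (c / p * p) p ⟩
      suc (c / p) * p                    ∎
      where
      shuffle : ∀ x y z → x + y + z ≡ y + (x + z)
      shuffle = solve-∀
    undo : ∀ x → x + c + (p ∸ c % p) ≈ x
    undo x = trans (cong (_% p) (trans (+-assoc x c _) (cong (x +_) c+c⁻≡))) ([m+kn]%n≡m%n x (suc (c / p)) p)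

  <-≈⇒≡ : ∀ {a b} → a < p → b < p → a ≈ b → a ≡ b
  <-≈⇒≡ {a} {b} a<p b<p a≈b = trans (sym (m<n⇒m%n≡m a<p)) (trans a≈b (m<n⇒m%n≡m b<p))

  +-solve-≈ : ∀ y c → y ≤ p → y + (c + (p ∸ y)) % p ≈ c
  +-solve-≈ y c y≤p = trans (+-cong-≈ {y} refl (%-≈ (c + (p ∸ y))))
    (trans (cong (_% p) (trans (shuffle y c (p ∸ y)) (cong (c +_) (m+[n∸m]≡n y≤p)))) ([m+n]%n≡m%n c p))
    where
    shuffle : ∀ x y z → x + (y + z) ≡ y + (x + z)
    shuffle = solve-∀

  <-∣⇒≡0 : ∀ s → s < p → p ∣ s → s ≡ 0
  <-∣⇒≡0 zero    _   _   = refl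
  <-∣⇒≡0 (suc s) s<p p∣s = ⊥-elim (<⇒≱ s<p (∣⇒≤ p∣s))

  module _ (p-prime : Prime p) where

    private
      *-cancelʳ-≈-≤ : ∀ m m' t → m ≤ m' → m' < p → 0 < t → t < p → m * t ≈ m' * t → m' ≡ m
      *-cancelʳ-≈-≤ m m' t m≤m' m'<p 0<t t<p mt≈m't =
        trans (sym (m+[n∸m]≡n m≤m')) (trans (cong (m +_) s≡0) (+-identityʳ m))
        where
        s = m' ∸ m
        st≈0 : s * t ≈ 0
        st≈0 = +-cancelʳ-≈ (s * t) 0 (m * t)
          (trans (cong (_% p) (trans (distrib s t m) (cong (_* t) (m+[n∸m]≡n m≤m')))) (sym mt≈m't))
          where
          distrib : ∀ s t m → s * t + m * t ≡ (m + s) * t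
          distrib = solve-∀
        s≡0 : s ≡ 0
        s≡0 with euclidsLemma s t p-prime (m%n≡0⇒n∣m (s * t) p (trans st≈0 (m*n%n≡0 0 p)))
        ... | inj₁ p∣s = <-∣⇒≡0 s (≤-<-trans (m∸n≤m m' m) m'<p) p∣s
        ... | inj₂ p∣t = ⊥-elim (<⇒≱ t<p (∣⇒≤ {{>-nonZero 0<t}} p∣t))

    *-cancelʳ-≈ : ∀ m m' t → m < p → m' < p → 0 < t → t < p → m * t ≈ m' * t → m ≡ m'
    *-cancelʳ-≈ m m' t m<p m'<p 0<t t<p mt≈m't with ≤-total m m'
    ... | inj₁ m≤m' = sym (*-cancelʳ-≈-≤ m m' t m≤m' m'<p 0<t t<p mt≈m't)
    ... | inj₂ m'≤m = *-cancelʳ-≈-≤ m' m t m'≤m m<p 0<t t<p (sym mt≈m't)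

injective⇒surjective : ∀ {n} (f : Fin n → Fin n) → (∀ {a b} → f a ≡ f b → a ≡ b) → ∀ y → ∃ λ x → f x ≡ y
injective⇒surjective {suc n} f f-inj y with anyFin? (λ x → f x ≟ᶠ y)
... | yes hit = hit
... | no miss with pigeonhole (n<1+n n) (λ x → punchOut {i = y} (λ y≡fx → miss (x , sym y≡fx)))
...   | i , j , i<j , fi≡fj =
  ⊥-elim (<ᶠ-irrefl (f-inj (punchOut-injective (λ e → miss (i , sym e)) (λ e → miss (j , sym e)) fi≡fj)) i<j)

module Geometry (p : ℕ) .{{_ : NonZero p}} (p-prime : Prime p) where

  open Modular p

  -- the parameter k of the line {v + k ≡ m u} of slope m through (u , v)
  slopeParam : Fin p → Fin p → Fin p → Fin p
  slopeParam m u v = fromℕ< (m%n<n (toℕ m * toℕ u + (p ∸ toℕ v)) p)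

  slopeParam-spec : ∀ m u v → toℕ v + toℕ (slopeParam m u v) ≈ toℕ m * toℕ u
  slopeParam-spec m u v rewrite toℕ-fromℕ< (m%n<n (toℕ m * toℕ u + (p ∸ toℕ v)) p) =
    +-solve-≈ (toℕ v) (toℕ m * toℕ u) (<⇒≤ (toℕ<n v))

  slopeParam-unique : ∀ m u v k → toℕ v + toℕ k ≈ toℕ m * toℕ u → k ≡ slopeParam m u v
  slopeParam-unique m u v k on = toℕ-injective (<-≈⇒≡ (toℕ<n k) (toℕ<n (slopeParam m u v))
    (+-cancelʳ-≈ (toℕ k) (toℕ (slopeParam m u v)) (toℕ v)
      (trans (cong (_% p) (+-comm (toℕ k) (toℕ v)))
        (trans on (trans (sym (slopeParam-spec m u v)) (cong (_% p) (+-comm (toℕ v) _)))))))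

  slopeParam-injective : ∀ m u v₁ v₂ → slopeParam m u v₁ ≡ slopeParam m u v₂ → v₁ ≡ v₂
  slopeParam-injective m u v₁ v₂ k≡ = toℕ-injective (<-≈⇒≡ (toℕ<n v₁) (toℕ<n v₂)
    (+-cancelʳ-≈ (toℕ v₁) (toℕ v₂) (toℕ (slopeParam m u v₁))
      (trans (slopeParam-spec m u v₁)
        (sym (subst (λ k → toℕ v₂ + toℕ k ≈ toℕ m * toℕ u) (sym k≡) (slopeParam-spec m u v₂))))))

  lineParam : Dir p → Point p → Fin p
  lineParam nothing  (u , v) = u
  lineParam (just m) (u , v) = slopeParam m u v

  onLine≡δ : ∀ d k P → ⟦ onLine p (d , k) P ⟧ ≡ δ k (lineParam d P)
  onLine≡δ nothing  k (u , v) = δ-sym u k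
  onLine≡δ (just m) k (u , v) with (toℕ v + toℕ k) % p ≟ (toℕ m * toℕ u) % p
  ... | yes on  = sym (trans (cong (λ x → δ x (slopeParam m u v)) (slopeParam-unique m u v k on)) (δ-refl _))
  ... | no off  =
    sym (δ-≢ (λ k≡ → off (subst (λ x → toℕ v + toℕ x ≈ toℕ m * toℕ u) (sym k≡) (slopeParam-spec m u v))))

  throughSlope≡δ : ∀ d P Q → ⟦ throughSlope p d P Q ⟧ ≡ δ (lineParam d P) (lineParam d Q)
  throughSlope≡δ d P Q = trans (⟦any⟧≡∑ _ (allFin p) (subst (_≤ 1) (sym ∑≡δ) (⟦⟧≤1 _))) ∑≡δ
    where
    ∑≡δ : ∑[ k ∈ allFin p ] ⟦ onLine p (d , k) P ∧ onLine p (d , k) Q ⟧ ≡ δ (lineParam d P) (lineParam d Q)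
    ∑≡δ = trans (∑-cong (allFin p) λ k →
                  trans (⟦⟧-∧ (onLine p (d , k) P) _) (cong₂ _*_ (onLine≡δ d k P) (onLine≡δ d k Q)))
                (∑-δ p (lineParam d P) (λ k → δ k (lineParam d Q)))

  -- Subtracting the two line equations of each slope gives m t ≈ m' t with t = u₂ - u₁ ≠ 0.
  private
    slopes-≈ : ∀ m m' a c k k' b t → a + k ≈ m * b → c + k ≈ m * (b + t) →
               a + k' ≈ m' * b → c + k' ≈ m' * (b + t) → m * t ≈ m' * t
    slopes-≈ m m' a c k k' b t e₁ e₂ e₃ e₄ = sym (+-cancelʳ-≈ (m' * t) (m * t) (m * b + m' * b)
      (trans (cong (_% p) (lhs m m' b t)) (trans (sym (+-cong-≈ e₁ e₄))
        (trans (cong (_% p) (swap a c k k')) (trans (+-cong-≈ e₂ e₃) (cong (_% p) (rhs m m' b t)))))))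
      where
      swap : ∀ a c k k' → (a + k) + (c + k') ≡ (c + k) + (a + k')
      swap = solve-∀
      lhs : ∀ m m' b t → m' * t + (m * b + m' * b) ≡ m * b + m' * (b + t)
      lhs = solve-∀
      rhs : ∀ m m' b t → m * (b + t) + m' * b ≡ m * t + (m * b + m' * b)
      rhs = solve-∀

    slope-unique-< : ∀ m m' u₁ v₁ u₂ v₂ → toℕ u₁ < toℕ u₂ → slopeParam m u₁ v₁ ≡ slopeParam m u₂ v₂ →
                     slopeParam m' u₁ v₁ ≡ slopeParam m' u₂ v₂ → m ≡ m'
    slope-unique-< m m' u₁ v₁ u₂ v₂ u₁<u₂ k≡ k'≡ = toℕ-injective
      (*-cancelʳ-≈ p-prime (toℕ m) (toℕ m') t (toℕ<n m) (toℕ<n m') (m<n⇒0<n∸m u₁<u₂)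
        (≤-<-trans (m∸n≤m (toℕ u₂) (toℕ u₁)) (toℕ<n u₂))
        (slopes-≈ (toℕ m) (toℕ m') (toℕ v₁) (toℕ v₂)
                  (toℕ (slopeParam m u₁ v₁)) (toℕ (slopeParam m' u₁ v₁)) (toℕ u₁) t
          (slopeParam-spec m u₁ v₁) (at-u₂ m k≡) (slopeParam-spec m' u₁ v₁) (at-u₂ m' k'≡)))
      where
      t = toℕ u₂ ∸ toℕ u₁
      at-u₂ : ∀ m → slopeParam m u₁ v₁ ≡ slopeParam m u₂ v₂ →
              toℕ v₂ + toℕ (slopeParam m u₁ v₁) ≈ toℕ m * (toℕ u₁ + t)
      at-u₂ m k≡ = subst₂ (λ x y → toℕ v₂ + toℕ x ≈ toℕ m * y) (sym k≡) (sym (m+[n∸m]≡n (<⇒≤ u₁<u₂)))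
                          (slopeParam-spec m u₂ v₂)

  slope-unique : ∀ m m' u₁ v₁ u₂ v₂ → u₁ ≢ u₂ → slopeParam m u₁ v₁ ≡ slopeParam m u₂ v₂ →
                 slopeParam m' u₁ v₁ ≡ slopeParam m' u₂ v₂ → m ≡ m'
  slope-unique m m' u₁ v₁ u₂ v₂ u₁≢u₂ k≡ k'≡ with <-cmp (toℕ u₁) (toℕ u₂)
  ... | tri< u₁<u₂ _ _ = slope-unique-< m m' u₁ v₁ u₂ v₂ u₁<u₂ k≡ k'≡
  ... | tri≈ _ u₁≡u₂ _ = ⊥-elim (u₁≢u₂ (toℕ-injective u₁≡u₂))
  ... | tri> _ _ u₁>u₂ = slope-unique-< m m' u₂ v₂ u₁ v₁ u₁>u₂ (sym k≡) (sym k'≡)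

  -- The map m ↦ (the second coordinate at u₂ of the slope-m line through (u₁, v₁)) is injective,
  -- hence hits v₂.
  slope-exists : ∀ u₁ v₁ u₂ v₂ → u₁ ≢ u₂ → ∃ λ m → slopeParam m u₁ v₁ ≡ slopeParam m u₂ v₂
  slope-exists u₁ v₁ u₂ v₂ u₁≢u₂ =
    let m , fm≡v₂ = injective⇒surjective f f-injective v₂
    in m , subst (λ v → k m ≡ slopeParam m u₂ v) fm≡v₂ (on-f m)
    where
    k : Fin p → Fin p
    k m = slopeParam m u₁ v₁
    f : Fin p → Fin p
    f m = slopeParam m u₂ (k m)
    on-f : ∀ m → k m ≡ slopeParam m u₂ (f m)
    on-f m = slopeParam-unique m u₂ (f m) (k m)
      (trans (cong (_% p) (+-comm (toℕ (f m)) (toℕ (k m)))) (slopeParam-spec m u₂ (k m)))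
    f-injective : ∀ {a b} → f a ≡ f b → a ≡ b
    f-injective {a} {b} fa≡fb =
      slope-unique a b u₁ v₁ u₂ (f b) u₁≢u₂ (subst (λ v → k a ≡ slopeParam a u₂ v) fa≡fb (on-f a)) (on-f b)

  ∑-points : ∀ f → ∑ (points p) f ≡ ∑[ u ∈ allFin p ] ∑[ v ∈ allFin p ] f (u , v)
  ∑-points f = trans (∑-concatMap (allFin p) (λ u → map (u ,_) (allFin p)) f)
                     (∑-cong (allFin p) (λ u → ∑-map (allFin p) (u ,_) f))

  ∑-dirs : ∀ f → ∑ (dirs p) f ≡ f nothing + (∑[ m ∈ allFin p ] f (just m))
  ∑-dirs f = cong (f nothing +_) (∑-map (allFin p) just f)

  δᵖ : Point p → Point p → ℕ
  δᵖ (u₁ , v₁) (u₂ , v₂) = δ u₁ u₂ * δ v₁ v₂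

  δᵖ-refl : ∀ P → δᵖ P P ≡ 1
  δᵖ-refl (u , v) = cong₂ _*_ (δ-refl u) (δ-refl v)

  δᵖ-≢ : ∀ P Q → P ≢ Q → δᵖ P Q ≡ 0
  δᵖ-≢ (u₁ , v₁) (u₂ , v₂) P≢Q with u₁ ≟ᶠ u₂
  ... | no _     = refl
  ... | yes refl = cong (1 *_) (δ-≢ (P≢Q ∘ cong (u₁ ,_)))

  ∑-δᵖ : ∀ P (h : Point p → ℕ) → ∑[ Q ∈ points p ] δᵖ P Q * h Q ≡ h P
  ∑-δᵖ (u₁ , v₁) h = trans (∑-points _) (trans (∑-cong (allFin p) inner) (∑-δ p u₁ (λ u → h (u , v₁))))
    where
    inner : ∀ u → ∑[ v ∈ allFin p ] δ u₁ u * δ v₁ v * h (u , v) ≡ δ u u₁ * h (u , v₁)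
    inner u = trans (∑-cong (allFin p) (λ v → trans (*-assoc (δ u₁ u) (δ v₁ v) _)
                      (cong₂ (λ x y → x * (y * h (u , v))) (δ-sym u₁ u) (δ-sym v₁ v))))
                (trans (∑-*ˡ (allFin p) (δ u u₁) _) (cong (δ u u₁ *_) (∑-δ p v₁ (λ v → h (u , v)))))

  commonLines : ∀ P Q → ∑[ d ∈ dirs p ] δ (lineParam d P) (lineParam d Q) ≡ 1 + p * δᵖ P Q
  commonLines (u₁ , v₁) (u₂ , v₂) = trans (∑-dirs _) (by-cases (u₁ ≟ᶠ u₂) (v₁ ≟ᶠ v₂))
    where
    slopes : ℕ
    slopes = ∑[ m ∈ allFin p ] δ (slopeParam m u₁ v₁) (slopeParam m u₂ v₂)
    by-cases : Dec (u₁ ≡ u₂) → Dec (v₁ ≡ v₂) → δ u₁ u₂ + slopes ≡ 1 + p * (δ u₁ u₂ * δ v₁ v₂)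
    by-cases (yes refl) (yes refl) = begin
      δ u₁ u₁ + slopes                ≡⟨ cong₂ _+_ (δ-refl u₁) every-slope ⟩
      1 + p * 1                       ≡⟨ cong (λ x → 1 + p * x) (δᵖ-refl (u₁ , v₁)) ⟨
      1 + p * δᵖ (u₁ , v₁) (u₁ , v₁)  ∎
      where
      open ≡-Reasoning
      every-slope : slopes ≡ p * 1
      every-slope = trans (∑-cong (allFin p) λ m → δ-refl (slopeParam m u₁ v₁)) (∑-allFin-const p 1)
    by-cases (yes refl) (no v₁≢v₂) = begin
      δ u₁ u₁ + slopes                ≡⟨ cong₂ _+_ (δ-refl u₁) no-slope ⟩
      1 + p * 0                       ≡⟨ cong (λ x → 1 + p * x) distinct ⟨
      1 + p * δᵖ (u₁ , v₁) (u₁ , v₂)  ∎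
      where
      open ≡-Reasoning
      distinct : δᵖ (u₁ , v₁) (u₁ , v₂) ≡ 0
      distinct = δᵖ-≢ (u₁ , v₁) (u₁ , v₂) (v₁≢v₂ ∘ cong proj₂)
      no-slope : slopes ≡ p * 0
      no-slope = trans (∑-cong (allFin p) λ m → δ-≢ (v₁≢v₂ ∘ slopeParam-injective m u₁ v₁ v₂))
                       (∑-allFin-const p 0)
    by-cases (no u₁≢u₂) _ = begin
      δ u₁ u₂ + slopes                ≡⟨ cong₂ _+_ (δ-≢ u₁≢u₂) one-slope ⟩
      1                               ≡⟨ cong suc (*-zeroʳ p) ⟨
      1 + p * 0                       ≡⟨ cong (λ x → 1 + p * x) distinct ⟨
      1 + p * δᵖ (u₁ , v₁) (u₂ , v₂)  ∎
      where
      open ≡-Reasoning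
      distinct : δᵖ (u₁ , v₁) (u₂ , v₂) ≡ 0
      distinct = δᵖ-≢ (u₁ , v₁) (u₂ , v₂) (u₁≢u₂ ∘ cong proj₁)
      one-slope : slopes ≡ 1
      one-slope =
        let m₀ , k≡ = slope-exists u₁ v₁ u₂ v₂ u₁≢u₂
            only-m₀ : ∀ m → m ≢ m₀ → δ (slopeParam m u₁ v₁) (slopeParam m u₂ v₂) ≡ 0
            only-m₀ m m≢m₀ = δ-≢ (λ k'≡ → m≢m₀ (slope-unique m m₀ u₁ v₁ u₂ v₂ u₁≢u₂ k'≡ k≡))
        in trans (∑-tabulate-single (λ m → δ (slopeParam m u₁ v₁) (slopeParam m u₂ v₂)) (λ m → m) m₀ only-m₀)
                 (trans (cong (λ k → δ k (slopeParam m₀ u₂ v₂)) k≡) (δ-refl _))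

  before : Point p → Point p → ℕ
  before P Q = ⟦ ⌊ index p P <? index p Q ⌋ ⟧

  index-injective : ∀ P Q → index p P ≡ index p Q → P ≡ Q
  index-injective (u₁ , v₁) (u₂ , v₂) i≡ = cong₂ _,_ (toℕ-injective u₁≡u₂) (toℕ-injective v₁≡v₂)
    where
    index%p : ∀ u v → (toℕ u * p + toℕ v) % p ≡ toℕ v
    index%p u v = trans (cong (_% p) (+-comm (toℕ u * p) (toℕ v)))
                        (trans ([m+kn]%n≡m%n (toℕ v) (toℕ u) p) (m<n⇒m%n≡m (toℕ<n v)))
    v₁≡v₂ : toℕ v₁ ≡ toℕ v₂
    v₁≡v₂ = trans (sym (index%p u₁ v₁)) (trans (cong (_% p) i≡) (index%p u₂ v₂))
    u₁≡u₂ : toℕ u₁ ≡ toℕ u₂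
    u₁≡u₂ = *-cancelʳ-≡ (toℕ u₁) (toℕ u₂) p
              (+-cancelʳ-≡ (toℕ v₁) _ _ (trans i≡ (cong (toℕ u₂ * p +_) (sym v₁≡v₂))))

  before-trichotomy : ∀ P Q → before P Q + before Q P + δᵖ P Q ≡ 1
  before-trichotomy P Q with index p P <? index p Q | index p Q <? index p P
  ... | yes P<Q | yes Q<P = ⊥-elim (<-asym P<Q Q<P)
  ... | yes P<Q | no _    = cong (1 +_) (δᵖ-≢ P Q (<⇒≢ P<Q ∘ cong (index p)))
  ... | no _    | yes Q<P = cong (1 +_) (δᵖ-≢ P Q (>⇒≢ Q<P ∘ cong (index p)))
  ... | no P≮Q  | no Q≮P  =
    subst (λ Q → δᵖ P Q ≡ 1) (index-injective P Q (≤∧≮⇒≡ (≮⇒≥ Q≮P) P≮Q)) (δᵖ-refl P)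

  module Counting (U : SubsetF p) where

    χ : Point p → ℕ
    χ P = ⟦ inU p U P ⟧

    N : ℕ
    N = card p U

    N≡∑χ : N ≡ ∑ (points p) χ
    N≡∑χ = count≡∑ (inU p U) (points p)

    lineCount≡∑ : ∀ d k → lineCount p U (d , k) ≡ ∑[ P ∈ points p ] χ P * δ k (lineParam d P)
    lineCount≡∑ d k = trans (count≡∑ _ (points p))
      (∑-cong (points p) λ P → trans (⟦⟧-∧ (inU p U P) _) (cong (χ P *_) (onLine≡δ d k P)))

    ∑-lineCount : ∀ d → ∑[ k ∈ allFin p ] lineCount p U (d , k) ≡ N
    ∑-lineCount d = begin
      ∑[ k ∈ allFin p ] lineCount p U (d , k)                          ≡⟨ ∑-cong (allFin p) (lineCount≡∑ d) ⟩
      ∑[ k ∈ allFin p ] ∑[ P ∈ points p ] χ P * δ k (lineParam d P)    ≡⟨ ∑-comm (allFin p) (points p) _ ⟩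
      ∑[ P ∈ points p ] ∑[ k ∈ allFin p ] χ P * δ k (lineParam d P)    ≡⟨ ∑-cong (points p) one-line ⟩
      ∑ (points p) χ                                                   ≡⟨ N≡∑χ ⟨
      N                                                                ∎
      where
      open ≡-Reasoning
      one-line : ∀ P → ∑[ k ∈ allFin p ] χ P * δ k (lineParam d P) ≡ χ P
      one-line P = trans (∑-*ˡ (allFin p) (χ P) _) (trans (cong (χ P *_) (∑-δ≡1 p (lineParam d P))) (*-identityʳ (χ P)))

    collinear : Dir p → Point p → Point p → ℕ
    collinear d P Q = χ P * χ Q * δ (lineParam d P) (lineParam d Q)

    squareSum : Dir p → ℕ
    squareSum d = ∑[ k ∈ allFin p ] lineCount p U (d , k) * lineCount p U (d , k)

    squareSum≡∑collinear : ∀ d → squareSum d ≡ ∑[ P ∈ points p ] ∑[ Q ∈ points p ] collinear d P Q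
    squareSum≡∑collinear d = begin
      squareSum d
        ≡⟨ ∑-cong (allFin p) square ⟩
      ∑[ k ∈ allFin p ] ∑[ P ∈ points p ] ∑[ Q ∈ points p ] on k P * on k Q
        ≡⟨ ∑-comm (allFin p) (points p) _ ⟩
      ∑[ P ∈ points p ] ∑[ k ∈ allFin p ] ∑[ Q ∈ points p ] on k P * on k Q
        ≡⟨ ∑-cong (points p) (λ P → ∑-comm (allFin p) (points p) _) ⟩
      ∑[ P ∈ points p ] ∑[ Q ∈ points p ] ∑[ k ∈ allFin p ] on k P * on k Q
        ≡⟨ ∑-cong (points p) (λ P → ∑-cong (points p) (same-line P)) ⟩
      ∑[ P ∈ points p ] ∑[ Q ∈ points p ] collinear d P Q ∎
      where
      open ≡-Reasoning
      on : Fin p → Point p → ℕ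
      on k P = χ P * δ k (lineParam d P)
      square : ∀ k → lineCount p U (d , k) * lineCount p U (d , k) ≡ ∑[ P ∈ points p ] ∑[ Q ∈ points p ] on k P * on k Q
      square k = trans (cong₂ _*_ (lineCount≡∑ d k) (lineCount≡∑ d k))
        (trans (sym (∑-*ʳ (points p) _ (on k)))
               (∑-cong (points p) (λ P → sym (∑-*ˡ (points p) (on k P) (on k)))))
      same-line : ∀ P Q → ∑[ k ∈ allFin p ] on k P * on k Q ≡ collinear d P Q
      same-line P Q = trans (∑-cong (allFin p) (λ k → regroup (χ P) (χ Q) (δ k (lineParam d P)) (δ k (lineParam d Q))))
        (trans (∑-*ˡ (allFin p) (χ P * χ Q) _) (cong (χ P * χ Q *_) (∑-δ p (lineParam d P) (λ k → δ k (lineParam d Q)))))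
        where
        regroup : ∀ x y u w → x * u * (y * w) ≡ x * y * (u * w)
        regroup = solve-∀

    pairCount≡∑collinear : ∀ d → pairCount p U d ≡ ∑[ P ∈ points p ] ∑[ Q ∈ points p ] before P Q * collinear d P Q
    pairCount≡∑collinear d = ∑-cong (points p) λ P → trans (count≡∑ _ (points p)) (∑-cong (points p) λ Q → begin
      ⟦ inU p U P ∧ inU p U Q ∧ ⌊ index p P <? index p Q ⌋ ∧ throughSlope p d P Q ⟧
        ≡⟨ trans (⟦⟧-∧ (inU p U P) _) (cong (χ P *_)
             (trans (⟦⟧-∧ (inU p U Q) _) (cong (χ Q *_) (⟦⟧-∧ ⌊ index p P <? index p Q ⌋ _)))) ⟩
      χ P * (χ Q * (before P Q * ⟦ throughSlope p d P Q ⟧))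
        ≡⟨ cong (λ x → χ P * (χ Q * (before P Q * x))) (throughSlope≡δ d P Q) ⟩
      χ P * (χ Q * (before P Q * δ (lineParam d P) (lineParam d Q)))
        ≡⟨ regroup (χ P) (χ Q) (before P Q) _ ⟩
      before P Q * collinear d P Q ∎)
      where
      open ≡-Reasoning
      regroup : ∀ x y l e → x * (y * (l * e)) ≡ l * (x * y * e)
      regroup = solve-∀

    collinear-sym : ∀ d P Q → collinear d P Q ≡ collinear d Q P
    collinear-sym d P Q = cong₂ _*_ (*-comm (χ P) (χ Q)) (δ-sym (lineParam d P) (lineParam d Q))

    collinear-refl : ∀ d P → collinear d P P ≡ χ P
    collinear-refl d P = trans (cong₂ _*_ (⟦⟧-idem (inU p U P)) (δ-refl (lineParam d P))) (*-identityʳ (χ P))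

    -- Split ordered pairs (P, Q) into P before Q, Q before P, and P = Q.
    squareSum≡pairCount : ∀ d → squareSum d ≡ 2 * pairCount p U d + N
    squareSum≡pairCount d = begin
      squareSum d
        ≡⟨ squareSum≡∑collinear d ⟩
      ∑[ P ∈ points p ] ∑[ Q ∈ points p ] collinear d P Q
        ≡⟨ ∑-cong (points p) split ⟩
      ∑[ P ∈ points p ] (A P + B P + C P)
        ≡⟨ trans (∑-+ (points p) _ C) (cong (_+ ∑ (points p) C) (∑-+ (points p) A B)) ⟩
      ∑ (points p) A + ∑ (points p) B + ∑ (points p) C
        ≡⟨ cong₂ _+_ (cong₂ _+_ A≡pairCount (trans B-swap A≡pairCount)) C-diag ⟩
      pairCount p U d + pairCount p U d + N
        ≡⟨ cong (λ x → pairCount p U d + x + N) (+-identityʳ _) ⟨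
      2 * pairCount p U d + N ∎
      where
      open ≡-Reasoning
      A B C : Point p → ℕ
      A P = ∑[ Q ∈ points p ] before P Q * collinear d P Q
      B P = ∑[ Q ∈ points p ] before Q P * collinear d P Q
      C P = ∑[ Q ∈ points p ] δᵖ P Q * collinear d P Q
      A≡pairCount : ∑ (points p) A ≡ pairCount p U d
      A≡pairCount = sym (pairCount≡∑collinear d)
      split : ∀ P → ∑[ Q ∈ points p ] collinear d P Q ≡ A P + B P + C P
      split P = trans (∑-cong (points p) λ Q → trans (sym (*-identityˡ _))
                        (trans (cong (_* collinear d P Q) (sym (before-trichotomy P Q))) (distrib (before P Q) _ _ _)))
                (trans (∑-+ (points p) _ _) (cong (_+ C P) (∑-+ (points p) _ _)))
        where
        distrib : ∀ x y z w → (x + y + z) * w ≡ x * w + y * w + z * w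
        distrib = solve-∀
      B-swap : ∑ (points p) B ≡ ∑ (points p) A
      B-swap = trans (∑-comm (points p) (points p) _)
                     (∑-cong (points p) λ Q → ∑-cong (points p) λ P → cong (before Q P *_) (collinear-sym d P Q))
      C-diag : ∑ (points p) C ≡ N
      C-diag = trans (∑-cong (points p) λ P → trans (∑-δᵖ P (collinear d P)) (collinear-refl d P)) (sym N≡∑χ)

    ∑-squareSum : ∑ (dirs p) squareSum ≡ N * (N + p)
    ∑-squareSum = begin
      ∑ (dirs p) squareSum
        ≡⟨ ∑-cong (dirs p) squareSum≡∑collinear ⟩
      ∑[ d ∈ dirs p ] ∑[ P ∈ points p ] ∑[ Q ∈ points p ] collinear d P Q
        ≡⟨ ∑-comm (dirs p) (points p) _ ⟩
      ∑[ P ∈ points p ] ∑[ d ∈ dirs p ] ∑[ Q ∈ points p ] collinear d P Q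
        ≡⟨ ∑-cong (points p) (λ P → ∑-comm (dirs p) (points p) _) ⟩
      ∑[ P ∈ points p ] ∑[ Q ∈ points p ] ∑[ d ∈ dirs p ] collinear d P Q
        ≡⟨ ∑-cong (points p) (λ P → ∑-cong (points p) (all-dirs P)) ⟩
      ∑[ P ∈ points p ] ∑[ Q ∈ points p ] (χ P * χ Q + p * (δᵖ P Q * (χ P * χ Q)))
        ≡⟨ ∑-cong (points p) row ⟩
      ∑[ P ∈ points p ] (χ P * N + p * χ P)
        ≡⟨ ∑-+ (points p) _ _ ⟩
      (∑[ P ∈ points p ] χ P * N) + (∑[ P ∈ points p ] p * χ P)
        ≡⟨ cong₂ _+_ (∑-*ʳ (points p) N χ) (∑-*ˡ (points p) p χ) ⟩
      ∑ (points p) χ * N + p * ∑ (points p) χ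
        ≡⟨ cong (λ x → x * N + p * x) N≡∑χ ⟨
      N * N + p * N
        ≡⟨ sym (trans (*-distribˡ-+ N N p) (cong (N * N +_) (*-comm N p))) ⟩
      N * (N + p) ∎
      where
      open ≡-Reasoning
      all-dirs : ∀ P Q → ∑[ d ∈ dirs p ] collinear d P Q ≡ χ P * χ Q + p * (δᵖ P Q * (χ P * χ Q))
      all-dirs P Q = trans (∑-*ˡ (dirs p) (χ P * χ Q) _)
                           (trans (cong (χ P * χ Q *_) (commonLines P Q)) (expand (χ P * χ Q) p (δᵖ P Q)))
        where
        expand : ∀ x p e → x * (1 + p * e) ≡ x + p * (e * x)
        expand = solve-∀
      row : ∀ P → ∑[ Q ∈ points p ] (χ P * χ Q + p * (δᵖ P Q * (χ P * χ Q))) ≡ χ P * N + p * χ P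
      row P = trans (∑-+ (points p) _ _) (cong₂ _+_
        (trans (∑-*ˡ (points p) (χ P) χ) (cong (χ P *_) (sym N≡∑χ)))
        (trans (∑-*ˡ (points p) p _) (cong (p *_) (trans (∑-δᵖ P (λ Q → χ P * χ Q)) (⟦⟧-idem (inU p U P))))))

    poorDir : Dir p → Bool
    poorDir d = any (λ k → poorLine p U (d , k)) (allFin p)

    richDir∨poorDir≡specialDir : ∀ d → richDir p U d ∨ poorDir d ≡ specialDir p U d
    richDir∨poorDir≡specialDir d = sym (any-∨ _ _ (allFin p))

    rich specialNotRich notSpecial : Dir p → ℕ
    rich           d = ⟦ richDir p U d ⟧
    specialNotRich d = ⟦ not (richDir p U d) ∧ poorDir d ⟧
    notSpecial     d = ⟦ not (specialDir p U d) ⟧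

    ⟦special⟧≡ : ∀ d → ⟦ specialDir p U d ⟧ ≡ rich d + specialNotRich d
    ⟦special⟧≡ d = subst (λ s → ⟦ s ⟧ ≡ rich d + specialNotRich d) (richDir∨poorDir≡specialDir d)
                         (⟦∨⟧ (richDir p U d) (poorDir d))

    direction-classes : ∀ d → rich d + specialNotRich d + notSpecial d ≡ 1
    direction-classes d = subst (λ s → rich d + specialNotRich d + ⟦ not s ⟧ ≡ 1) (richDir∨poorDir≡specialDir d)
                                (⟦⟧-partition (richDir p U d) (poorDir d))

    ∑-classes : ∀ (w : Dir p → ℕ) →
      (∑[ d ∈ dirs p ] rich d * w d) + (∑[ d ∈ dirs p ] specialNotRich d * w d) + (∑[ d ∈ dirs p ] notSpecial d * w d)
        ≡ ∑ (dirs p) w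
    ∑-classes w = trans (cong (_+ ∑ (dirs p) νw) (sym (∑-+ (dirs p) ρw τw)))
      (trans (sym (∑-+ (dirs p) (λ d → ρw d + τw d) νw)) (∑-cong (dirs p) λ d →
        trans (distrib (rich d) (specialNotRich d) (notSpecial d) (w d))
              (trans (cong (_* w d) (direction-classes d)) (*-identityˡ (w d)))))
      where
      ρw τw νw : Dir p → ℕ
      ρw d = rich d * w d
      τw d = specialNotRich d * w d
      νw d = notSpecial d * w d
      distrib : ∀ x y z w → x * w + y * w + z * w ≡ (x + y + z) * w
      distrib = solve-∀

    module Bounds (b r : ℕ) (r<p : r < p) (N+r≡np : N + r ≡ suc b * p) where

      notRich⇒lineCount≤n : ∀ ℓ → richLine p U ℓ ≡ false → lineCount p U ℓ ≤ suc b
      notRich⇒lineCount≤n ℓ notRich = s≤s⁻¹ (*-cancelˡ-< p _ _ (<-≤-trans pa<N+p N+p≤p[n+1]))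
        where
        pa<N+p : p * lineCount p U ℓ < N + p
        pa<N+p = ≰⇒> (⌊⌋≡false⇒¬ (N + p ≤? p * lineCount p U ℓ) notRich)
        N+p≤p[n+1] : N + p ≤ p * suc (suc b)
        N+p≤p[n+1] = ≤-trans (+-monoˡ-≤ p (m≤m+n N r))
          (≤-reflexive (trans (cong (_+ p) N+r≡np) (trans (+-comm (suc b * p) p) (*-comm (suc (suc b)) p))))

      notPoor⇒n∸1≤lineCount : ∀ ℓ → poorLine p U ℓ ≡ false → b ≤ lineCount p U ℓ
      notPoor⇒n∸1≤lineCount ℓ notPoor with b ≤? lineCount p U ℓ
      ... | yes b≤a = b≤a
      ... | no b≰a  =
        ⊥-elim (<-asym r<p (+-cancelˡ-< (p * a + p) p r (≤-<-trans p[a+2]≤N+r (+-monoˡ-< r N<pa+p))))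
        where
        a = lineCount p U ℓ
        N<pa+p : N < p * a + p
        N<pa+p = ≰⇒> (⌊⌋≡false⇒¬ (p * a + p ≤? N) notPoor)
        p[a+2]≤N+r : p * a + p + p ≤ N + r
        p[a+2]≤N+r = begin
          p * a + p + p   ≡⟨ expand p a ⟩
          p * suc (suc a) ≤⟨ *-monoʳ-≤ p (s≤s (≰⇒> b≰a)) ⟩
          p * suc b       ≡⟨ trans (*-comm p (suc b)) (sym N+r≡np) ⟩
          N + r           ∎
          where
          open ≤-Reasoning
          expand : ∀ p a → p * a + p + p ≡ p * suc (suc a)
          expand = solve-∀

      squareSum-notRich : ∀ d → richDir p U d ≡ false → squareSum d ≤ suc b * N
      squareSum-notRich d notRich = begin
        squareSum d
          ≤⟨ ∑-mono-≤ (allFin p) (λ k → *-monoˡ-≤ (lineCount p U (d , k))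
                (notRich⇒lineCount≤n (d , k) (any-allFin-false _ notRich k))) ⟩
        ∑[ k ∈ allFin p ] suc b * lineCount p U (d , k)
          ≡⟨ ∑-*ˡ (allFin p) (suc b) _ ⟩
        suc b * (∑[ k ∈ allFin p ] lineCount p U (d , k))
          ≡⟨ cong (suc b *_) (∑-lineCount d) ⟩
        suc b * N ∎
        where open ≤-Reasoning

      square-on-chord : ∀ a → b ≤ a → a ≤ suc b → a * a + suc b * b ≡ (2 * b + 1) * a
      square-on-chord a b≤a a≤n with m≤n⇒m<n∨m≡n b≤a
      ... | inj₁ b<a rewrite ≤-antisym a≤n b<a = at-n b
        where
        at-n : ∀ b → suc b * suc b + suc b * b ≡ (2 * b + 1) * suc b
        at-n = solve-∀
      ... | inj₂ refl = at-b b
        where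
        at-b : ∀ b → b * b + suc b * b ≡ (2 * b + 1) * b
        at-b = solve-∀

      squareSum-notSpecial : ∀ d → specialDir p U d ≡ false → squareSum d + p * (suc b * b) ≡ (2 * b + 1) * N
      squareSum-notSpecial d notSpecial = begin
        squareSum d + p * (suc b * b)
          ≡⟨ cong (squareSum d +_) (∑-allFin-const p (suc b * b)) ⟨
        squareSum d + (∑[ _ ∈ allFin p ] suc b * b)
          ≡⟨ ∑-+ (allFin p) _ _ ⟨
        ∑[ k ∈ allFin p ] (a k * a k + suc b * b)
          ≡⟨ ∑-cong (allFin p) on-chord ⟩
        ∑[ k ∈ allFin p ] (2 * b + 1) * a k
          ≡⟨ ∑-*ˡ (allFin p) (2 * b + 1) a ⟩
        (2 * b + 1) * ∑ (allFin p) a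
          ≡⟨ cong ((2 * b + 1) *_) (∑-lineCount d) ⟩
        (2 * b + 1) * N ∎
        where
        open ≡-Reasoning
        a : Fin p → ℕ
        a k = lineCount p U (d , k)
        on-chord : ∀ k → a k * a k + suc b * b ≡ (2 * b + 1) * a k
        on-chord k = square-on-chord (a k) (notPoor⇒n∸1≤lineCount (d , k) (∨-conicalʳ _ _ neither))
                                           (notRich⇒lineCount≤n (d , k) (∨-conicalˡ _ _ neither))
          where
          neither = any-allFin-false _ notSpecial k

      E F G : ℕ
      E = numRich p U
      F = ∑ (dirs p) specialNotRich
      G = ∑ (dirs p) notSpecial

      E≡∑ : E ≡ ∑ (dirs p) rich
      E≡∑ = count≡∑ (richDir p U) (dirs p)

      numSpecial≡E+F : numSpecial p U ≡ E + F
      numSpecial≡E+F = trans (count≡∑ (specialDir p U) (dirs p))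
        (trans (∑-cong (dirs p) ⟦special⟧≡) (trans (∑-+ (dirs p) rich specialNotRich) (cong (_+ F) (sym E≡∑))))

      E+F+G≡p+1 : E + F + G ≡ p + 1
      E+F+G≡p+1 = begin
        E + F + G
          ≡⟨ cong (λ e → e + F + G) E≡∑ ⟩
        ∑ (dirs p) rich + F + G
          ≡⟨ cong (_+ G) (∑-+ (dirs p) rich specialNotRich) ⟨
        (∑[ d ∈ dirs p ] (rich d + specialNotRich d)) + G
          ≡⟨ ∑-+ (dirs p) _ notSpecial ⟨
        ∑[ d ∈ dirs p ] (rich d + specialNotRich d + notSpecial d)
          ≡⟨ ∑-cong (dirs p) direction-classes ⟩
        ∑[ _ ∈ dirs p ] 1
          ≡⟨ trans (∑-dirs (λ _ → 1)) (cong suc (∑-allFin-const p 1)) ⟩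
        1 + p * 1
          ≡⟨ trans (cong suc (*-identityʳ p)) (+-comm 1 p) ⟩
        p + 1 ∎
        where open ≡-Reasoning

      rich-squareSum : ∑[ d ∈ dirs p ] rich d * squareSum d ≡ 2 * richPairSum p U + E * N
      rich-squareSum = begin
        ∑[ d ∈ dirs p ] rich d * squareSum d
          ≡⟨ ∑-cong (dirs p) (λ d → cong (rich d *_) (squareSum≡pairCount d)) ⟩
        ∑[ d ∈ dirs p ] rich d * (2 * pairCount p U d + N)
          ≡⟨ ∑-cong (dirs p) (λ d → distrib (rich d) (pairCount p U d) N) ⟩
        ∑[ d ∈ dirs p ] (2 * (rich d * pairCount p U d) + rich d * N)
          ≡⟨ ∑-+ (dirs p) (λ d → 2 * (rich d * pairCount p U d)) (λ d → rich d * N) ⟩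
        (∑[ d ∈ dirs p ] 2 * (rich d * pairCount p U d)) + (∑[ d ∈ dirs p ] rich d * N)
          ≡⟨ cong₂ _+_ (∑-*ˡ (dirs p) 2 (λ d → rich d * pairCount p U d)) (∑-*ʳ (dirs p) N rich) ⟩
        2 * (∑[ d ∈ dirs p ] rich d * pairCount p U d) + ∑ (dirs p) rich * N
          ≡⟨ cong₂ (λ x e → 2 * x + e * N) X≡ E≡∑ ⟨
        2 * richPairSum p U + E * N ∎
        where
        open ≡-Reasoning
        distrib : ∀ x c N → x * (2 * c + N) ≡ 2 * (x * c) + x * N
        distrib = solve-∀
        X≡ : richPairSum p U ≡ ∑[ d ∈ dirs p ] rich d * pairCount p U d
        X≡ = ∑-cong (dirs p) λ d → if-then-0≡⟦⟧* (richDir p U d) (pairCount p U d)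

      specialNotRich-squareSum : ∑[ d ∈ dirs p ] specialNotRich d * squareSum d ≤ F * suc b * N
      specialNotRich-squareSum = begin
        ∑[ d ∈ dirs p ] specialNotRich d * squareSum d
          ≤⟨ ∑-mono-≤ (dirs p) (λ d → ⟦⟧*-mono-≤ _ λ snr →
                                                               squareSum-notRich d (not≡true⇒≡false (∧-conicalˡ _ _ snr))) ⟩
        ∑[ d ∈ dirs p ] specialNotRich d * (suc b * N)
          ≡⟨ ∑-*ʳ (dirs p) _ specialNotRich ⟩
        F * (suc b * N)
          ≡⟨ *-assoc F (suc b) N ⟨
        F * suc b * N ∎
        where open ≤-Reasoning

      notSpecial-squareSum : (∑[ d ∈ dirs p ] notSpecial d * squareSum d) + G * p * suc b * b ≡ G * (2 * b + 1) * N
      notSpecial-squareSum = begin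
        (∑[ d ∈ dirs p ] notSpecial d * squareSum d) + G * p * suc b * b
          ≡⟨ cong ((∑[ d ∈ dirs p ] notSpecial d * squareSum d) +_)
                  (trans (regroup G p (suc b) b) (sym (∑-*ʳ (dirs p) (p * (suc b * b)) notSpecial))) ⟩
        (∑[ d ∈ dirs p ] notSpecial d * squareSum d) + (∑[ d ∈ dirs p ] notSpecial d * (p * (suc b * b)))
          ≡⟨ ∑-+ (dirs p) (λ d → notSpecial d * squareSum d) (λ d → notSpecial d * (p * (suc b * b))) ⟨
        ∑[ d ∈ dirs p ] (notSpecial d * squareSum d + notSpecial d * (p * (suc b * b)))
          ≡⟨ ∑-cong (dirs p) (λ d → trans (sym (*-distribˡ-+ (notSpecial d) _ _))
               (⟦⟧*-cong _ λ ns → squareSum-notSpecial d (not≡true⇒≡false ns))) ⟩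
        ∑[ d ∈ dirs p ] notSpecial d * ((2 * b + 1) * N)
          ≡⟨ trans (∑-*ʳ (dirs p) _ notSpecial) (sym (*-assoc G _ N)) ⟩
        G * (2 * b + 1) * N ∎
        where
        open ≡-Reasoning
        regroup : ∀ G p n b → G * p * n * b ≡ G * (p * (n * b))
        regroup = solve-∀

-- With n = 1 + b, p = n + r + 1 + e and N = n p − r, the target is the sum of (n + 1) times each of
-- the three facts about S₁, S₂ and N (N + p), r b times the bound on E + F, and (n + 1) W times
-- E + F + G = p + 1, where q and s are the slacks of the two inequalities. Moving every term to the
-- side where it is added turns this into a semiring identity.
private
  pairSum-identity : ∀ b r e E F G S₁ S₂ X q s →
    let n = suc b ; p = n + (r + suc e) ; N = n + suc e + b * p
        W = (2 * b + 1) * (n + suc e) + b * b * p in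
    2 * (n + 1) * X + 2 * n * r * (n + suc e)
      + ((n + 1) * (N * (N + p)) + (n + 1) * (S₁ + q) + (n + 1) * (S₂ + G * p * n * b)
         + r * b * ((n + 1) * (E + F) + s) + (n + 1) * W * (E + F + G))
    ≡ (n + 1) * (r + suc e) * N + (n + 1) * b * N * E + ((n + 1) * q + r * b * s)
      + ((n + 1) * (2 * X + E * N + S₁ + S₂) + (n + 1) * (F * n * N) + (n + 1) * (G * (2 * b + 1) * N)
         + r * b * ((n + 1) + (n + suc e)) + (n + 1) * W * (p + 1))
  pairSum-identity = solve-∀

  pairSum-inequality-normalised : ∀ b r e E F G S₁ S₂ X →
    let n = suc b ; p = n + (r + suc e) ; N = n + suc e + b * p in
    2 * X + E * N + S₁ + S₂ ≡ N * (N + p) → S₁ ≤ F * n * N → S₂ + G * p * n * b ≡ G * (2 * b + 1) * N →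
    (n + 1) * (E + F) ≤ (n + 1) + (n + suc e) → E + F + G ≡ p + 1 →
    (n + 1) * (r + suc e) * N + (n + 1) * b * N * E ≤ 2 * (n + 1) * X + 2 * n * r * (n + suc e)
  pairSum-inequality-normalised b r e E F G S₁ S₂ X squares S₁≤ S₂≡ E+F≤ E+F+G≡ =
    subst (lhs ≤_) (sym rhs≡lhs+slack) (m≤m+n lhs slack)
    where
    n = suc b
    p = n + (r + suc e)
    N = n + suc e + b * p
    W = (2 * b + 1) * (n + suc e) + b * b * p
    q = F * n * N ∸ S₁
    s = (n + 1) + (n + suc e) ∸ (n + 1) * (E + F)
    lhs = (n + 1) * (r + suc e) * N + (n + 1) * b * N * E
    rhs = 2 * (n + 1) * X + 2 * n * r * (n + suc e)
    slack = (n + 1) * q + r * b * s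
    combined : (n + 1) * (N * (N + p)) + (n + 1) * (S₁ + q) + (n + 1) * (S₂ + G * p * n * b)
                 + r * b * ((n + 1) * (E + F) + s) + (n + 1) * W * (E + F + G)
             ≡ (n + 1) * (2 * X + E * N + S₁ + S₂) + (n + 1) * (F * n * N) + (n + 1) * (G * (2 * b + 1) * N)
                 + r * b * ((n + 1) + (n + suc e)) + (n + 1) * W * (p + 1)
    combined = cong₂ _+_ (cong₂ _+_ (cong₂ _+_ (cong₂ _+_ (cong ((n + 1) *_) (sym squares))
                 (cong ((n + 1) *_) (m+[n∸m]≡n S₁≤))) (cong ((n + 1) *_) S₂≡))
                 (cong (r * b *_) (m+[n∸m]≡n E+F≤))) (cong ((n + 1) * W *_) E+F+G≡)
    rhs≡lhs+slack : rhs ≡ lhs + slack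
    rhs≡lhs+slack = +-cancelʳ-≡ _ rhs (lhs + slack)
      (trans (pairSum-identity b r e E F G S₁ S₂ X q s) (cong (lhs + slack +_) (sym combined)))

pairSum-inequality : ∀ b p r N E F G S₁ S₂ X → suc b < p → r < p ∸ suc b → N + r ≡ suc b * p →
  2 * X + E * N + S₁ + S₂ ≡ N * (N + p) → S₁ ≤ F * suc b * N → S₂ + G * p * suc b * b ≡ G * (2 * b + 1) * N →
  (suc b + 1) * (E + F) ≤ (suc b + 1) + (p ∸ r) → E + F + G ≡ p + 1 →
  (suc b + 1) * (p ∸ suc b) * N + (suc b + 1) * b * N * E ≤ 2 * (suc b + 1) * X + 2 * suc b * r * (p ∸ r)
pairSum-inequality b p r N E F G S₁ S₂ X n<p r<p∸n N+r≡np = normalise p N p≡ N≡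
  where
  e = p ∸ suc b ∸ suc r
  p≡ : p ≡ suc b + (r + suc e)
  p≡ = sym (trans (cong (suc b +_) (trans (+-suc r e) (m+[n∸m]≡n r<p∸n))) (m+[n∸m]≡n (<⇒≤ n<p)))
  N≡ : N ≡ suc b + suc e + b * p
  N≡ = +-cancelʳ-≡ r N _ (trans N+r≡np (trans (cong (suc b *_) p≡)
         (trans (expand b r e) (cong (λ p → suc b + suc e + b * p + r) (sym p≡)))))
    where
    expand : ∀ b r e → suc b * (suc b + (r + suc e)) ≡ suc b + suc e + b * (suc b + (r + suc e)) + r
    expand = solve-∀
  p∸r≡ : suc b + (r + suc e) ∸ r ≡ suc b + suc e
  p∸r≡ = trans (cong (_∸ r) (shuffle b r e)) (m+n∸n≡m (suc b + suc e) r)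
    where
    shuffle : ∀ b r e → suc b + (r + suc e) ≡ suc b + suc e + r
    shuffle = solve-∀
  normalise : ∀ p N → p ≡ suc b + (r + suc e) → N ≡ suc b + suc e + b * p →
    2 * X + E * N + S₁ + S₂ ≡ N * (N + p) → S₁ ≤ F * suc b * N → S₂ + G * p * suc b * b ≡ G * (2 * b + 1) * N →
    (suc b + 1) * (E + F) ≤ (suc b + 1) + (p ∸ r) → E + F + G ≡ p + 1 →
    (suc b + 1) * (p ∸ suc b) * N + (suc b + 1) * b * N * E ≤ 2 * (suc b + 1) * X + 2 * suc b * r * (p ∸ r)
  normalise _ _ refl refl rewrite m+n∸m≡n (suc b) (r + suc e) | p∸r≡ =
    pairSum-inequality-normalised b r e E F G S₁ S₂ X

proposition2p7 : (p : ℕ) .{{_ : NonZero p}} → Prime p →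
    (U : SubsetF p) (n r : ℕ) → 1 ≤ n → n < p → r < p ∸ n →
    card p U + r ≡ n * p →
    ¬ (Σ (Fin n → Line p) λ ls → CoveredBy p n U ls) →
    (n + 1) * numSpecial p U ≤ (n + 1) + (p ∸ r) →
    (n + 1) * (p ∸ n) * card p U + (n + 1) * (n ∸ 1) * card p U * numRich p U
      ≤ 2 * (n + 1) * richPairSum p U + 2 * n * r * (p ∸ r)
proposition2p7 p p-prime U (suc b) r (s≤s z≤n) n<p r<p∸n N+r≡np _ D-bound =
  pairSum-inequality b p r N E F G S₁ S₂ (richPairSum p U) n<p r<p∸n N+r≡np
    squares specialNotRich-squareSum notSpecial-squareSum
    (subst (λ D → (suc b + 1) * D ≤ (suc b + 1) + (p ∸ r)) numSpecial≡E+F D-bound) E+F+G≡p+1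
  where
  open Geometry p p-prime
  open Counting U
  open Bounds b r (≤-trans r<p∸n (m∸n≤m p (suc b))) N+r≡np
  S₁ S₂ : ℕ
  S₁ = ∑[ d ∈ dirs p ] specialNotRich d * squareSum d
  S₂ = ∑[ d ∈ dirs p ] notSpecial d * squareSum d
  squares : 2 * richPairSum p U + E * N + S₁ + S₂ ≡ N * (N + p)
  squares = trans (cong (λ x → x + S₁ + S₂) (sym rich-squareSum)) (trans (∑-classes squareSum) ∑-squareSum)
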